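{- For every natural number $n$, $f(n) = \sigma(n_j)$, where $n_j$ is the practical component of $n$.
   Context: For a natural number $n$, let $f(n)$ be the largest integer such that every integer in $\{1,\dots,f(n)\}$ is a sum of distinct divisors of $n$; $\sigma$ is the sum-of-divisors function. Write $n = p_1^{e_1}\cdots p_r^{e_r}$ with primes $p_1<\dots<p_r$ and $e_i \geq 1$; put $n_0 := 1$ and $n_j := \prod_{i=1}^{j} p_i^{e_i}$ for $1 \leq j \leq r$. Let $j$ be the least index $0 \leq j < r$ with $p_{j+1} > \sigma(n_j)+1$, and $j = r$ if no such index exists. Then $n_j$ is called the practical component of $n$. -}

module Defs where

open import Data.Nat using (ℕ; zero; suc; _+_; _*_; _^_; _≤_; _<_; _<?_)
open import Data.Nat.Divisibility using (_∣?_)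
open import Data.Nat.Primality using (Prime)
open import Data.List using (List; []; _∷_; filter; applyUpTo; map)
open import Data.Nat.ListAction using (sum; product)
open import Data.List.Relation.Binary.Sublist.Propositional using (_⊆_)
open import Data.List.Relation.Unary.All using (All)
open import Data.List.Relation.Unary.Linked using (Linked)
open import Data.Product using (Σ; _×_; _,_; proj₁)
open import Relation.Binary.PropositionalEquality using (_≡_)
open import Relation.Nullary using (yes; no)

-- The list of positive divisors of n, in increasing order (without repetitions):
-- those d ∈ {1, …, n} with d ∣ n.  (For n = 0 this list is empty.)
divisors : ℕ → List ℕ
divisors n = filter (_∣? n) (applyUpTo suc n)

σ : ℕ → ℕ
σ n = sum (divisors n)

-- m is a sum of distinct divisors of n: m is the sum of some sub-collection
-- (sublist) of the repetition-free list of divisors of n.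
SumOfDistinctDivisors : ℕ → ℕ → Set
SumOfDistinctDivisors n m = Σ (List ℕ) λ S → S ⊆ divisors n × sum S ≡ m

AllUpToRepresentable : ℕ → ℕ → Set
AllUpToRepresentable n k = ∀ m → 1 ≤ m → m ≤ k → SumOfDistinctDivisors n m

-- k = f(n): k is the largest integer such that every integer in {1,…,k}
-- is a sum of distinct divisors of n.
IsF : ℕ → ℕ → Set
IsF n k = AllUpToRepresentable n k × (∀ k' → AllUpToRepresentable n k' → k' ≤ k)

IsFactorisation : ℕ → List (ℕ × ℕ) → Set
IsFactorisation n fs =
  All (λ pe → Prime (proj₁ pe)) fs
  × All (λ pe → 1 ≤ Data.Product.proj₂ pe) fs
  × Linked _<_ (map proj₁ fs)
  × product (map (λ pe → proj₁ pe ^ Data.Product.proj₂ pe) fs) ≡ n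

-- Practical component.  practicalGo nⱼ [(p_{j+1},e_{j+1}), …, (p_r,e_r)]:
-- if no primes remain, j = r and the answer is nⱼ; if p_{j+1} > σ(nⱼ)+1 this is the
-- least such j and the answer is nⱼ; otherwise move on to n_{j+1} = nⱼ · p_{j+1}^{e_{j+1}}.
practicalGo : ℕ → List (ℕ × ℕ) → ℕ
practicalGo acc [] = acc
practicalGo acc ((p , e) ∷ fs) with σ acc + 1 <? p
... | yes _ = acc
... | no _  = practicalGo (acc * p ^ e) fs

practicalComponent : List (ℕ × ℕ) → ℕ
practicalComponent fs = practicalGo 1 fs

-- Write n = c · Q with c = n_j.  The divisors of c realise every sum up to σ(c): going from m to
-- m p^(k+1) (p ∤ m, p ≤ σ(m) + 1) appends the block p^(k+1) · divisors(m) to the divisor list of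
-- m p^k, and appending c · D to a list A whose sub-sums fill [0, sum A] keeps that property as long
-- as c ≤ sum A + 1 and D has it too.  Conversely σ(c) + 1 is not such a sum: a divisor of n not
-- dividing c has a nontrivial common factor with Q, all of whose prime factors exceed σ(c) + 1,
-- while divisors of c alone add up to at most σ(c).
module Submission where

open import Defs

open import Data.Nat
open import Data.Nat.Coprimality as Coprime using (Coprime; coprime-divisor; gcd≡1⇒coprime)
open import Data.Nat.Divisibility
open import Data.Nat.GCD using (gcd; gcd[m,n]∣m; gcd[m,n]∣n; gcd[m,n]≡0⇒m≡0)
open import Data.Nat.ListAction using (sum; product)
open import Data.Nat.ListAction.Properties using (sum-++; sum-↭)
open import Data.Nat.Primality
  using ( Prime; _Rough_; prime⇒irreducible; prime⇒nonZero; prime⇒nonTrivial; prime⇒rough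
        ; euclidsLemma; rough-1; rough⇒≤; rough∧∣⇒rough)
open import Data.Nat.Properties
open import Algebra.Properties.CommutativeSemigroup *-commutativeSemigroup using (x∙yz≈y∙xz)
open import Data.List using (List; []; _∷_; _++_; map; filter; applyUpTo)
open import Data.List.Membership.DecPropositional _≟_ using (_∈?_)
open import Data.List.Membership.Propositional using (_∈_; find)
open import Data.List.Membership.Propositional.Properties
  using (∈-filter⁺; ∈-filter⁻; ∈-applyUpTo⁺; ∈-applyUpTo⁻; ∈-map⁺; ∈-map⁻
        ; ∈-++⁺ˡ; ∈-++⁺ʳ; ∈-++⁻)
open import Data.List.Membership.Propositional.Properties.WithK using (unique∧set⇒bag)
open import Data.List.Relation.Binary.BagAndSetEquality using (_∼[_]_; set; ∼bag⇒↭)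
open import Data.List.Relation.Binary.Sublist.Propositional
  using (_⊆_; []; _∷_; _∷ʳ_; lookup; from∈)
import Data.List.Relation.Binary.Sublist.Propositional.Properties as Sublist
open import Data.List.Relation.Binary.Subset.Propositional using () renaming (_⊆_ to _⊆ₛ_)
open import Data.List.Relation.Unary.All using (All; []; _∷_)
import Data.List.Relation.Unary.All as All
import Data.List.Relation.Unary.All.Properties as All
open import Data.List.Relation.Unary.AllPairs using (AllPairs; []; _∷_)
open import Data.List.Relation.Unary.Linked.Properties using (Linked⇒AllPairs)
open import Data.List.Relation.Unary.Unique.Propositional using (Unique)
import Data.List.Relation.Unary.Unique.Propositional.Properties as Unique
open import Data.Product using (Σ-syntax; ∃-syntax; ∃₂; _×_; _,_; proj₁; proj₂)
open import Data.Sum using (_⊎_; inj₁; inj₂)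
open import Function.Base using (_∘_)
open import Function.Bundles using (Equivalence; mk⇔)
open import Relation.Binary.PropositionalEquality
open import Relation.Nullary using (¬_; yes; no; contradiction)

private
  variable
    x : ℕ
    A D L L′ S T : List ℕ

SublistSum : List ℕ → ℕ → Set
SublistSum L x = Σ[ T ∈ List ℕ ] T ⊆ L × sum T ≡ x

Complete : List ℕ → Set
Complete L = ∀ x → x ≤ sum L → SublistSum L x

sum-mono-⊆ : T ⊆ L → sum T ≤ sum L
sum-mono-⊆ []           = ≤-refl
sum-mono-⊆ (y ∷ʳ T⊆L)   = ≤-trans (sum-mono-⊆ T⊆L) (m≤n+m _ y)
sum-mono-⊆ (refl ∷ T⊆L) = +-monoʳ-≤ _ (sum-mono-⊆ T⊆L)

∈⇒≤sum : x ∈ L → x ≤ sum L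
∈⇒≤sum {x} x∈L = subst (_≤ _) (+-identityʳ x) (sum-mono-⊆ (from∈ x∈L))

sum-map-*ˡ : ∀ c L → sum (map (c *_) L) ≡ c * sum L
sum-map-*ˡ c []      = sym (*-zeroʳ c)
sum-map-*ˡ c (x ∷ L) = trans (cong (c * x +_) (sum-map-*ˡ c L)) (sym (*-distribˡ-+ c x (sum L)))

sum-++-map-*ˡ : ∀ A c D → sum (A ++ map (c *_) D) ≡ sum A + c * sum D
sum-++-map-*ˡ A c D = trans (sum-++ A _) (cong (sum A +_) (sum-map-*ˡ c D))

Unique-⊆ : T ⊆ L → Unique L → Unique T
Unique-⊆ []           L!       = L!
Unique-⊆ (y ∷ʳ T⊆L)   (_ ∷ L!) = Unique-⊆ T⊆L L!
Unique-⊆ (refl ∷ T⊆L) (x∉ ∷ L!) = All.anti-mono (lookup T⊆L) x∉ ∷ Unique-⊆ T⊆L L!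

sum-unique-∼set : Unique S → Unique T → S ∼[ set ] T → sum S ≡ sum T
sum-unique-∼set S! T! S∼T = sum-↭ (∼bag⇒↭ (unique∧set⇒bag S! T! S∼T))

unique∧⊆ₛ⇒sublistSum : Unique L → Unique S → S ⊆ₛ L → SublistSum L (sum S)
unique∧⊆ₛ⇒sublistSum {L} {S} L! S! S⊆L =
  filter (_∈? S) L , Sublist.filter-⊆ (_∈? S) L ,
  sum-unique-∼set (Unique.filter⁺ (_∈? S) {L} L!) S!
    (mk⇔ (proj₂ ∘ ∈-filter⁻ (_∈? S) {xs = L}) (λ x∈S → ∈-filter⁺ (_∈? S) (S⊆L x∈S) x∈S))

sublistSum-mono : Unique L → Unique L′ → L ⊆ₛ L′ → SublistSum L x → SublistSum L′ x
sublistSum-mono L! L′! L⊆L′ (T , T⊆L , refl) =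
  unique∧⊆ₛ⇒sublistSum L′! (Unique-⊆ T⊆L L!) (L⊆L′ ∘ lookup T⊆L)

complete-resp-∼set : Unique L → Unique L′ → L ∼[ set ] L′ → Complete L → Complete L′
complete-resp-∼set L! L′! L∼L′ L-complete x x≤ =
  sublistSum-mono L! L′! (Equivalence.to L∼L′)
    (L-complete x (subst (x ≤_) (sym (sum-unique-∼set L! L′! L∼L′)) x≤))

sublistSum-++-*ˡ : ∀ {r b} c → SublistSum A r → SublistSum D b →
                   SublistSum (A ++ map (c *_) D) (r + c * b)
sublistSum-++-*ˡ c (T , T⊆A , refl) (U , U⊆D , refl) =
  T ++ map (c *_) U , Sublist.++⁺ T⊆A (Sublist.map⁺ (c *_) U⊆D) , sum-++-map-*ˡ T c U

-- Since c ≤ a + 1, the intervals [c b, c b + a] for b ≤ d cover [0, a + c d].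
≤-+*-decompose : ∀ {a c} d {x} → c ≤ suc a → x ≤ a + c * d →
                 ∃₂ λ r b → r ≤ a × b ≤ d × x ≡ r + c * b
≤-+*-decompose {a} {c} zero {x} _ x≤ =
  x , 0 , subst (x ≤_) (trans (cong (a +_) (*-zeroʳ c)) (+-identityʳ a)) x≤ , z≤n ,
  sym (trans (cong (x +_) (*-zeroʳ c)) (+-identityʳ x))
≤-+*-decompose {a} {c} (suc d) {x} c≤1+a x≤ with x ≤? a + c * d
... | yes x≤′ = let r , b , r≤a , b≤d , x≡ = ≤-+*-decompose d c≤1+a x≤′ in
                r , b , r≤a , m≤n⇒m≤1+n b≤d , x≡
... | no x≰   = x ∸ c * suc d , suc d , m≤n+o⇒m∸n≤o x (c * suc d) (subst (x ≤_) (+-comm a _) x≤) ,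
                ≤-refl , sym (m∸n+n≡m c*[1+d]≤x)
  where
  c*[1+d]≤x : c * suc d ≤ x
  c*[1+d]≤x = begin
    c * suc d     ≡⟨ *-suc c d ⟩
    c + c * d     ≤⟨ +-monoˡ-≤ (c * d) c≤1+a ⟩
    suc a + c * d ≤⟨ ≰⇒> x≰ ⟩
    x             ∎
    where open ≤-Reasoning

complete-++-*ˡ : ∀ {c} → c ≤ suc (sum A) → Complete A → Complete D → Complete (A ++ map (c *_) D)
complete-++-*ˡ {A} {D} {c} c≤ A-complete D-complete x x≤
  with r , b , r≤ , b≤ , refl ← ≤-+*-decompose (sum D) c≤ (subst (x ≤_) (sum-++-map-*ˡ A c D) x≤)
  = sublistSum-++-*ˡ c (A-complete r r≤) (D-complete b b≤)

Practical : ℕ → Set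
Practical n = Complete (divisors n)

∈-divisors⁺ : ∀ {d} n .{{_ : NonZero n}} → d ∣ n → d ∈ divisors n
∈-divisors⁺ {zero}  n 0∣n = contradiction (0∣⇒≡0 0∣n) (≢-nonZero⁻¹ n)
∈-divisors⁺ {suc d} n d∣n = ∈-filter⁺ (_∣? n) (∈-applyUpTo⁺ suc (∣⇒≤ d∣n)) d∣n

∈-divisors⁻ : ∀ {d} n → d ∈ divisors n → d ∣ n
∈-divisors⁻ n d∈ = proj₂ (∈-filter⁻ (_∣? n) {xs = applyUpTo suc n} d∈)

∈-divisors⇒nonZero : ∀ {d} n → d ∈ divisors n → NonZero d
∈-divisors⇒nonZero n d∈
  with _ , _ , refl ← ∈-applyUpTo⁻ suc (proj₁ (∈-filter⁻ (_∣? n) {xs = applyUpTo suc n} d∈)) = _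

divisors-⊆ₛ : ∀ {m n} .{{_ : NonZero n}} → m ∣ n → divisors m ⊆ₛ divisors n
divisors-⊆ₛ {m} {n} m∣n d∈ = ∈-divisors⁺ n (∣-trans (∈-divisors⁻ m d∈) m∣n)

divisors-unique : ∀ n → Unique (divisors n)
divisors-unique n =
  Unique.filter⁺ (_∣? n) (Unique.applyUpTo⁺₁ suc n (λ i<j _ → <⇒≢ i<j ∘ suc-injective))

1-practical : Practical 1
1-practical zero       _        = [] , 1 ∷ʳ [] , refl
1-practical (suc zero) _        = 1 ∷ [] , refl ∷ [] , refl
1-practical (2+ _)     (s≤s ())

prime⇒∤1 : ∀ {p} → Prime p → p ∤ 1
prime⇒∤1 p-prime p∣1 = nonTrivial⇒≢1 {{prime⇒nonTrivial p-prime}} (∣1⇒≡1 p∣1)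

prime∧∤⇒coprime : ∀ {p n} → Prime p → p ∤ n → Coprime p n
prime∧∤⇒coprime p-prime p∤n (d∣p , d∣n) with prime⇒irreducible p-prime d∣p
... | inj₁ d≡1  = d≡1
... | inj₂ refl = contradiction d∣n p∤n

∣-prime*-split : ∀ {p a d} → Prime p → d ∣ p * a → d ∣ a ⊎ ∃[ q ] d ≡ p * q × q ∣ a
∣-prime*-split {p} {a} {d} p-prime d∣pa with p ∣? d
... | no p∤d = inj₁ (coprime-divisor (Coprime.sym (prime∧∤⇒coprime p-prime p∤d)) d∣pa)
... | yes (divides q refl) =
  inj₂ (q , *-comm q p , *-cancelʳ-∣ p (subst (q * p ∣_) (*-comm p a) d∣pa))
  where instance _ = prime⇒nonZero p-prime

prime∣^⇒∣ : ∀ {q p} → Prime q → ∀ e → q ∣ p ^ e → q ∣ p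
prime∣^⇒∣ q-prime zero q∣1 = contradiction q∣1 (prime⇒∤1 q-prime)
prime∣^⇒∣ {p = p} q-prime (suc e) q∣p^[1+e] with euclidsLemma p (p ^ e) q-prime q∣p^[1+e]
... | inj₁ q∣p   = q∣p
... | inj₂ q∣p^e = prime∣^⇒∣ q-prime e q∣p^e

∤-*-^ : ∀ {q a p} .{{_ : NonZero p}} → Prime q → p < q → q ∤ a → ∀ e → q ∤ a * p ^ e
∤-*-^ {a = a} {p} q-prime p<q q∤a e q∣ap^e with euclidsLemma a (p ^ e) q-prime q∣ap^e
... | inj₁ q∣a   = q∤a q∣a
... | inj₂ q∣p^e = <⇒≱ p<q (∣⇒≤ (prime∣^⇒∣ q-prime e q∣p^e))

module _ {m p : ℕ} .{{m≢0 : NonZero m}} (p-prime : Prime p) (p∤m : p ∤ m) where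

  private
    instance
      p≢0 : NonZero p
      p≢0 = prime⇒nonZero p-prime

    p^≢0 : ∀ k → NonZero (p ^ k)
    p^≢0 k = m^n≢0 p k

    ∈-divisors-*p^⁺ : ∀ k {d} → d ∣ m * p ^ k → d ∈ divisors (m * p ^ k)
    ∈-divisors-*p^⁺ k = ∈-divisors⁺ (m * p ^ k) {{m*n≢0 m (p ^ k) {{m≢0}} {{p^≢0 k}}}}

  divisorsSplit : ℕ → List ℕ
  divisorsSplit k = divisors (m * p ^ k) ++ map (p ^ suc k *_) (divisors m)

  ∣-*-p^suc-split : ∀ k {d} → d ∣ m * p ^ suc k → d ∣ m * p ^ k ⊎ ∃[ a ] a ∣ m × d ≡ p ^ suc k * a
  ∣-*-p^suc-split k {d} d∣ with ∣-prime*-split p-prime (subst (d ∣_) (x∙yz≈y∙xz m p (p ^ k)) d∣)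
  ... | inj₁ d∣mp^k = inj₁ d∣mp^k
  ∣-*-p^suc-split zero    _ | inj₂ (q , refl , q∣m*1) =
    inj₂ (q , subst (q ∣_) (*-identityʳ m) q∣m*1 , cong (_* q) (sym (*-identityʳ p)))
  ∣-*-p^suc-split (suc k) _ | inj₂ (q , refl , q∣) with ∣-*-p^suc-split k q∣
  ... | inj₁ q∣mp^k         = inj₁ (subst (p * q ∣_) (sym (x∙yz≈y∙xz m p (p ^ k))) (*-monoʳ-∣ p q∣mp^k))
  ... | inj₂ (a , a∣m , refl) = inj₂ (a , a∣m , sym (*-assoc p (p ^ suc k) a))

  divisorsSplit-∼set : ∀ k → divisorsSplit k ∼[ set ] divisors (m * p ^ suc k)
  divisorsSplit-∼set k = mk⇔ to from
    where
    to : ∀ {d} → d ∈ divisorsSplit k → d ∈ divisors (m * p ^ suc k)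
    to d∈ with ∈-++⁻ (divisors (m * p ^ k)) d∈
    ... | inj₁ d∈′ =
      ∈-divisors-*p^⁺ (suc k) (∣-trans (∈-divisors⁻ (m * p ^ k) d∈′) (*-monoʳ-∣ m (n∣m*n p)))
    ... | inj₂ d∈′ with a , a∈ , refl ← ∈-map⁻ (p ^ suc k *_) d∈′ =
      ∈-divisors-*p^⁺ (suc k)
        (subst (_∣ m * p ^ suc k) (*-comm a (p ^ suc k)) (*-monoˡ-∣ (p ^ suc k) (∈-divisors⁻ m a∈)))
    from : ∀ {d} → d ∈ divisors (m * p ^ suc k) → d ∈ divisorsSplit k
    from d∈ with ∣-*-p^suc-split k (∈-divisors⁻ (m * p ^ suc k) d∈)
    ... | inj₁ d∣                = ∈-++⁺ˡ (∈-divisors-*p^⁺ k d∣)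
    ... | inj₂ (a , a∣m , refl) =
      ∈-++⁺ʳ (divisors (m * p ^ k)) (∈-map⁺ (p ^ suc k *_) (∈-divisors⁺ m a∣m))

  -- The two blocks are disjoint because p^(k+1) ∣ m p^k would force p ∣ m.
  divisorsSplit-unique : ∀ k → Unique (divisorsSplit k)
  divisorsSplit-unique k =
    Unique.++⁺ (divisors-unique (m * p ^ k))
      (Unique.map⁺ (*-cancelˡ-≡ _ _ (p ^ suc k) {{p^≢0 (suc k)}}) (divisors-unique m)) disjoint
    where
    disjoint : ∀ {d} → ¬ (d ∈ divisors (m * p ^ k) × d ∈ map (p ^ suc k *_) (divisors m))
    disjoint (d∈ , d∈′) with a , _ , refl ← ∈-map⁻ (p ^ suc k *_) d∈′ =
      p∤m (*-cancelʳ-∣ (p ^ k) {{p^≢0 k}} (∣-trans (m∣m*n a) (∈-divisors⁻ (m * p ^ k) d∈)))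

  σ-*-p^suc : ∀ k → σ (m * p ^ suc k) ≡ σ (m * p ^ k) + p ^ suc k * σ m
  σ-*-p^suc k = begin
    σ (m * p ^ suc k)               ≡⟨ sum-unique-∼set split! mp^[1+k]! (divisorsSplit-∼set k) ⟨
    sum (divisorsSplit k)           ≡⟨ sum-++-map-*ˡ (divisors (m * p ^ k)) (p ^ suc k) (divisors m) ⟩
    σ (m * p ^ k) + p ^ suc k * σ m ∎
    where
    open ≡-Reasoning
    split!    = divisorsSplit-unique k
    mp^[1+k]! = divisors-unique (m * p ^ suc k)

  p^suc≤1+σ : p ≤ suc (σ m) → ∀ k → p ^ suc k ≤ suc (σ (m * p ^ k))
  p^suc≤1+σ p≤ zero rewrite *-identityʳ p | *-identityʳ m = p≤
  p^suc≤1+σ p≤ (suc k) = begin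
    p * p ^ suc k                         ≤⟨ *-monoˡ-≤ (p ^ suc k) p≤ ⟩
    suc (σ m) * p ^ suc k                 ≡⟨ cong (p ^ suc k +_) (*-comm (σ m) (p ^ suc k)) ⟩
    p ^ suc k + p ^ suc k * σ m           ≤⟨ +-monoˡ-≤ _ (p^suc≤1+σ p≤ k) ⟩
    suc (σ (m * p ^ k) + p ^ suc k * σ m) ≡⟨ cong suc (σ-*-p^suc k) ⟨
    suc (σ (m * p ^ suc k))               ∎
    where open ≤-Reasoning

  practical-*-p^ : Practical m → p ≤ suc (σ m) → ∀ e → Practical (m * p ^ e)
  practical-*-p^ m-practical p≤ zero    = subst Practical (sym (*-identityʳ m)) m-practical
  practical-*-p^ m-practical p≤ (suc k) =
    complete-resp-∼set (divisorsSplit-unique k) (divisors-unique (m * p ^ suc k)) (divisorsSplit-∼set k)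
      (complete-++-*ˡ (p^suc≤1+σ p≤ k) (practical-*-p^ m-practical p≤ k) m-practical)

rough-≤ : ∀ {m n o} → m ≤ n → n Rough o → m Rough o
rough-≤ m≤n n-rough o-divisor = n-rough (hasNonTrivialDivisor-≤ o-divisor m≤n)

-- Such a d shares the nontrivial factor gcd d b with b.
rough∧∣*∧∤⇒≤ : ∀ {m a b d} .{{_ : NonZero d}} → m Rough b → d ∣ a * b → d ∤ a → m ≤ d
rough∧∣*∧∤⇒≤ {m} {a} {b} {d} b-rough d∣ab d∤a with gcd d b in eq
... | 0    = contradiction (gcd[m,n]≡0⇒m≡0 eq) (≢-nonZero⁻¹ d)
... | 1    = contradiction (coprime-divisor (gcd≡1⇒coprime eq) (subst (d ∣_) (*-comm a b) d∣ab)) d∤a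
... | 2+ _ = ≤-trans (rough⇒≤ (rough∧∣⇒rough b-rough (subst (_∣ b) eq (gcd[m,n]∣n d b))))
                     (∣⇒≤ (subst (_∣ d) eq (gcd[m,n]∣m d b)))

rough-* : ∀ {m a b} → m Rough a → m Rough b → m Rough (a * b)
rough-* {a = a} a-rough b-rough (hasNonTrivialDivisor {d} d<m d∣ab) with d ∣? a
... | yes d∣a = a-rough (hasNonTrivialDivisor d<m d∣a)
... | no d∤a  = <⇒≱ d<m (rough∧∣*∧∤⇒≤ {{nonTrivial⇒nonZero d}} b-rough d∣ab d∤a)

rough-^ : ∀ {m a} → m Rough a → ∀ e → m Rough (a ^ e)
rough-^ {m} a-rough zero    = rough-1 m
rough-^     a-rough (suc e) = rough-* a-rough (rough-^ a-rough e)

primePowerProduct : List (ℕ × ℕ) → ℕ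
primePowerProduct fs = product (map (λ pe → proj₁ pe ^ proj₂ pe) fs)

rough-primePowerProduct : ∀ {m} fs → All (λ pe → Prime (proj₁ pe)) fs → All (λ pe → m ≤ proj₁ pe) fs →
                          m Rough primePowerProduct fs
rough-primePowerProduct {m} []             []                 []               = rough-1 m
rough-primePowerProduct     ((p , e) ∷ fs) (p-prime ∷ primes) (m≤p ∷ m≤primes) =
  rough-* (rough-^ (rough-≤ m≤p (prime⇒rough p-prime)) e) (rough-primePowerProduct fs primes m≤primes)

¬sumOfDistinctDivisors-1+σ : ∀ {c Q} .{{_ : NonZero (c * Q)}} → suc (σ c + 1) Rough Q →
                             ¬ SumOfDistinctDivisors (c * Q) (suc (σ c))
¬sumOfDistinctDivisors-1+σ {c} {Q} Q-rough (T , T⊆ , sumT≡) with All.all? (_∣? c) T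
... | yes all∣c
  with T′ , T′⊆ , sumT′≡
         ← unique∧⊆ₛ⇒sublistSum (divisors-unique c) (Unique-⊆ T⊆ (divisors-unique (c * Q)))
             (λ y∈T → ∈-divisors⁺ c {{m*n≢0⇒m≢0 c}} (All.lookup all∣c y∈T))
  = 1+n≰n (subst (_≤ σ c) (trans sumT′≡ sumT≡) (sum-mono-⊆ T′⊆))
... | no ¬all∣c
  with y , y∈T , y∤c ← find (All.¬All⇒Any¬ (_∣? c) T ¬all∣c)
  = 1+n≰n (begin
      suc (σ c + 1) ≤⟨ rough∧∣*∧∤⇒≤ {{y≢0}} Q-rough (∈-divisors⁻ (c * Q) y∈) y∤c ⟩
      y             ≤⟨ ∈⇒≤sum y∈T ⟩
      sum T         ≡⟨ trans sumT≡ (+-comm 1 (σ c)) ⟩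
      σ c + 1       ∎)
  where
  open ≤-Reasoning
  y∈  = lookup T⊆ y∈T
  y≢0 = ∈-divisors⇒nonZero (c * Q) y∈

IsF-intro : ∀ {n k} → AllUpToRepresentable n k → ¬ SumOfDistinctDivisors n (suc k) → IsF n k
IsF-intro k-representable ¬1+k =
  k-representable , λ k′ k′-representable → ≮⇒≥ (λ k<k′ → ¬1+k (k′-representable _ (s≤s z≤n) k<k′))

PracticalDecomposition : ℕ → ℕ → Set
PracticalDecomposition n c = Practical c × ∃[ Q ] n ≡ c * Q × suc (σ c + 1) Rough Q

practicalDecomposition⇒IsF : ∀ {n c} .{{_ : NonZero n}} → PracticalDecomposition n c → IsF n (σ c)
practicalDecomposition⇒IsF {c = c} (c-practical , Q , refl , Q-rough) =
  IsF-intro {c * Q} {σ c}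
    (λ x _ x≤σc → sublistSum-mono (divisors-unique c) (divisors-unique (c * Q))
                                  (divisors-⊆ₛ (m∣m*n {c} Q)) (c-practical x x≤σc))
    (¬sumOfDistinctDivisors-1+σ {c} Q-rough)

practicalGo-decomposition :
  ∀ fs {acc} .{{_ : NonZero acc}} → Practical acc →
  All (λ pe → Prime (proj₁ pe)) fs → AllPairs _<_ (map proj₁ fs) → All (λ pe → proj₁ pe ∤ acc) fs →
  PracticalDecomposition (acc * primePowerProduct fs) (practicalGo acc fs)
practicalGo-decomposition [] acc-practical _ _ _ = acc-practical , 1 , refl , rough-1 _
practicalGo-decomposition ((p , e) ∷ fs) {acc} acc-practical
                          (p-prime ∷ primes) (p<fs ∷ sorted) (p∤acc ∷ fs∤acc)
  with σ acc + 1 <? p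
... | yes σ+1<p =
  acc-practical , p ^ e * primePowerProduct fs , refl ,
  rough-≤ σ+1<p (rough-primePowerProduct ((p , e) ∷ fs) (p-prime ∷ primes) (≤-refl ∷ All.map <⇒≤ p<fs′))
  where p<fs′ = All.map⁻ p<fs
... | no σ+1≮p =
  subst (λ n → PracticalDecomposition n (practicalGo (acc * p ^ e) fs)) (*-assoc acc (p ^ e) _)
    (practicalGo-decomposition fs {{m*n≢0 acc (p ^ e)}}
       (practical-*-p^ p-prime p∤acc acc-practical (subst (p ≤_) (+-comm (σ acc) 1) (≮⇒≥ σ+1≮p)) e)
       primes sorted
       (All.zipWith (λ ((q-prime , p<q) , q∤acc) → ∤-*-^ q-prime p<q q∤acc e)
                    (All.zip (primes , All.map⁻ p<fs) , fs∤acc)))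
  where
  instance
    p≢0 : NonZero p
    p≢0 = prime⇒nonZero p-prime
    p^e≢0 : NonZero (p ^ e)
    p^e≢0 = m^n≢0 p e

lemma2p1 : (n : ℕ) → 1 ≤ n → (fs : List (ℕ × ℕ)) → IsFactorisation n fs →
    IsF n (σ (practicalComponent fs))
lemma2p1 n n≥1 fs (primes , _ , sorted , product≡n) =
  practicalDecomposition⇒IsF {c = practicalComponent fs} {{>-nonZero n≥1}} decomposition
  where
  decomposition : PracticalDecomposition n (practicalComponent fs)
  decomposition =
    subst (λ m → PracticalDecomposition m (practicalComponent fs)) (trans (*-identityˡ _) product≡n)
      (practicalGo-decomposition fs 1-practical primes (Linked⇒AllPairs <-trans sorted)
                                 (All.map prime⇒∤1 primes))
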